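{- Let $t\ge 2$ and $k>t$ be integers, let $2\le v_1\le v_2\le\cdots\le v_k$ be integers and $i\in\{1,\dots,k\}$. Then $$v_i\cdot(\bar{1},t-1)\text{ -LAN}(k-1,(v_1,\dots,v_{i-1},v_{i+1},\dots,v_k))\le(\bar{1},t)\text{ -LAN}(k,(v_1,\dots,v_{i-1},v_i,v_{i+1},\dots,v_k)).$$
   Context: For positive integers $N,k,t$ and $v_1,\dots,v_k$, consider $N\times k$ arrays $A=(a_{rj})$ whose $j$-th column has entries from a set $V_j$ with $|V_j|=v_j$. A $t$-way interaction is $T=\{(j,\sigma_j):j\in I\}$ with $I\subseteq\{1,\dots,k\}$, $|I|=t$, $\sigma_j\in V_j$; $\rho(A,T)$ is the set of rows $r$ with $a_{rj}=\sigma_j$ for all $j\in I$, and $\rho(A,\mathcal T)=\bigcup_{T\in\mathcal T}\rho(A,T)$. $A$ is a $(\bar1,t)$-LA$(N;k,(v_1,\dots,v_k))$ if for all sets $\mathcal T_1,\mathcal T_2$ of $t$-way interactions with $|\mathcal T_1|,|\mathcal T_2|\le 1$: $\rho(A,\mathcal T_1)=\rho(A,\mathcal T_2)\iff\mathcal T_1=\mathcal T_2$. $(\bar1,t)$-LAN$(k,(v_1,\dots,v_k))$ is the minimum $N$ for which such an array exists. -}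

module Defs where

open import Data.Nat using (ℕ; zero; suc; _≤_)
open import Data.Fin using (Fin; punchIn)
open import Data.Maybe using (Maybe; just; nothing)
open import Data.List using (allFin; map)
open import Data.Nat.ListAction using (sum)
open import Data.Product using (_×_)
open import Data.Empty using (⊥)
open import Relation.Binary.PropositionalEquality using (_≡_)

Sizes : ℕ → Set
Sizes k = Fin k → ℕ

Array : (N k : ℕ) → Sizes k → Set
Array N k v = Fin N → (j : Fin k) → Fin (v j)

-- A (partial) interaction: τ j = just σ means (j , σ) ∈ T; nothing means column j ∉ I.
PInteraction : (k : ℕ) → Sizes k → Set
PInteraction k v = (j : Fin k) → Maybe (Fin (v j))

isJustℕ : ∀ {A : Set} → Maybe A → ℕ
isJustℕ (just _) = 1
isJustℕ nothing  = 0

strength : ∀ {k v} → PInteraction k v → ℕ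
strength {k} τ = sum (map (λ j → isJustℕ (τ j)) (allFin k))

record Interaction (t k : ℕ) (v : Sizes k) : Set where
  constructor mkI
  field
    pairs   : PInteraction k v
    isT-way : strength pairs ≡ t

_≈I_ : ∀ {t k v} → Interaction t k v → Interaction t k v → Set
T₁ ≈I T₂ = ∀ j → Interaction.pairs T₁ j ≡ Interaction.pairs T₂ j

InRho : ∀ {N t k v} → Array N k v → Interaction t k v → Fin N → Set
InRho A T r = ∀ j σ → Interaction.pairs T j ≡ just σ → A r j ≡ σ

-- sets 𝒯 of t-way interactions with |𝒯| ≤ 1 are represented by Maybe (Interaction t k v)
InRhoSet : ∀ {N t k v} → Array N k v → Maybe (Interaction t k v) → Fin N → Set
InRhoSet A nothing  r = ⊥
InRhoSet A (just T) r = InRho A T r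

EqSet : ∀ {t k v} → Maybe (Interaction t k v) → Maybe (Interaction t k v) → Set
EqSet nothing   nothing   = Data.Unit.⊤ where import Data.Unit
EqSet nothing   (just _)  = ⊥
EqSet (just _)  nothing   = ⊥
EqSet (just T₁) (just T₂) = T₁ ≈I T₂

SameRows : ∀ {N t k v} → Array N k v → Maybe (Interaction t k v) → Maybe (Interaction t k v) → Set
SameRows A 𝒯₁ 𝒯₂ = ∀ r → (InRhoSet A 𝒯₁ r → InRhoSet A 𝒯₂ r) × (InRhoSet A 𝒯₂ r → InRhoSet A 𝒯₁ r)

IsLA : (t N k : ℕ) (v : Sizes k) → Array N k v → Set
IsLA t N k v A = ∀ (𝒯₁ 𝒯₂ : Maybe (Interaction t k v)) →
  (SameRows A 𝒯₁ 𝒯₂ → EqSet 𝒯₁ 𝒯₂) × (EqSet 𝒯₁ 𝒯₂ → SameRows A 𝒯₁ 𝒯₂)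

HasLA : (t N k : ℕ) (v : Sizes k) → Set
HasLA t N k v = Data.Product.Σ (Array N k v) (IsLA t N k v) where import Data.Product

IsLAN : (t k : ℕ) (v : Sizes k) → ℕ → Set
IsLAN t k v n = HasLA t n k v × (∀ m → HasLA t m k v → n ≤ m)

removeAt : ∀ {m} → Sizes (suc m) → Fin (suc m) → Sizes m
removeAt v i j = v (punchIn i j)

-- In a (1̄,t)-locating array A, fix a column i and a value σ of it. The rows of A
-- with entry σ in column i, with column i deleted, form a (1̄,t-1)-locating array:
-- a (t-1)-way interaction T of the remaining columns covers exactly the rows that
-- T ∪ {(i,σ)} covers in A, so two interactions with equal row sets there would
-- give two t-way interactions with equal row sets in A. Hence the rows of A split
-- into v_i classes, each with at least (1̄,t-1)-LAN(k-1, …) elements.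
module Submission where

open import Defs
open import Data.Nat using (ℕ; suc; _≤_; _<_; _*_; _∸_)
open import Data.Fin using (Fin)
import Data.Fin as F

open import Data.Nat using (zero; _+_)
open import Data.Nat.Properties using (+-suc)
open import Data.Nat.ListAction using (sum)
open import Data.Fin using (punchIn; punchOut; inject≤; remQuot; combine) renaming (zero to fz; suc to fs)
open import Data.Fin.Properties
  using (punchIn-punchOut; inject≤-injective; injective⇒≤; combine-remQuot)
open import Data.Maybe using (Maybe; just; nothing)
import Data.Maybe as Maybe
open import Data.Maybe.Properties using (just-injective)
open import Data.List using (List; allFin; filter; length; lookup)
open import Data.List.Properties using (map-tabulate)
import Data.List.Relation.Unary.All as All
open import Data.List.Relation.Unary.AllPairs using (_∷_)
import Data.List.Relation.Unary.Any as Any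
open import Data.List.Relation.Unary.Any.Properties using (lookup-index)
open import Data.List.Relation.Unary.Unique.Propositional using (Unique)
open import Data.List.Relation.Unary.Unique.Propositional.Properties using (filter⁺; allFin⁺)
open import Data.List.Membership.Propositional.Properties using (∈-lookup; ∈-filter⁺; ∈-filter⁻; ∈-allFin)
open import Data.Product using (Σ; ∃-syntax; _×_; _,_; proj₁; proj₂)
open import Data.Unit using (tt)
open import Function using (_∘_; Injective)
open import Relation.Nullary using (yes; no; contradiction)
open import Relation.Unary using (Decidable)
open import Relation.Binary.PropositionalEquality

Unique⇒lookup-injective : ∀ {A : Set} {xs : List A} → Unique xs → Injective _≡_ _≡_ (lookup xs)
Unique⇒lookup-injective (_ ∷ _)    {fz}   {fz}   _  = refl
Unique⇒lookup-injective (x∉ ∷ _)   {fz}   {fs j} eq = contradiction eq (All.lookup x∉ (∈-lookup j))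
Unique⇒lookup-injective (x∉ ∷ _)   {fs i} {fz}   eq = contradiction (sym eq) (All.lookup x∉ (∈-lookup i))
Unique⇒lookup-injective (_ ∷ uxs)  {fs i} {fs j} eq = cong fs (Unique⇒lookup-injective uxs eq)

record Enumeration {b : ℕ} (P : Fin b → Set) : Set where
  field
    size           : ℕ
    elem           : Fin size → Fin b
    elem-injective : Injective _≡_ _≡_ elem
    elem-sound     : ∀ p → P (elem p)
    elem-complete  : ∀ {r} → P r → ∃[ p ] elem p ≡ r

  injection≤ : ∀ {a} → a ≤ size → Σ (Fin a → Fin b) λ g → Injective _≡_ _≡_ g × (∀ p → P (g p))
  injection≤ a≤size =
    elem ∘ inj , inject≤-injective a≤size a≤size _ _ ∘ elem-injective , elem-sound ∘ inj
    where inj = λ p → inject≤ p a≤size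

enumerate : ∀ {b} {P : Fin b → Set} → Decidable P → Enumeration P
enumerate {b} P? = record
  { size           = length elems
  ; elem           = lookup elems
  ; elem-injective = Unique⇒lookup-injective (filter⁺ P? (allFin⁺ b))
  ; elem-sound     = λ p → proj₂ (∈-filter⁻ P? {xs = allFin b} (∈-lookup p))
  ; elem-complete  = λ {r} Pr → let r∈ = ∈-filter⁺ P? (∈-allFin r) Pr in Any.index r∈ , sym (lookup-index r∈)
  }
  where elems = filter P? (allFin b)

-- Through Fin (n * a) ≅ Fin n × Fin a the fibre injections glue into one injection into Fin b.
fibre-injections⇒*≤ : ∀ {a b n} (c : Fin b → Fin n) →
  (∀ σ → Σ (Fin a → Fin b) λ g → Injective _≡_ _≡_ g × (∀ p → c (g p) ≡ σ)) → n * a ≤ b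
fibre-injections⇒*≤ {a} {b} {n} c fibre = injective⇒≤ {f = glue} glue-injective
  where
  glue′ : Fin n × Fin a → Fin b
  glue′ (σ , p) = proj₁ (fibre σ) p

  glue′-injective : ∀ {x y} → glue′ x ≡ glue′ y → x ≡ y
  glue′-injective {σ , p} {τ , q} eq
    with refl ← trans (sym (proj₂ (proj₂ (fibre σ)) p)) (trans (cong c eq) (proj₂ (proj₂ (fibre τ)) q))
    = cong (σ ,_) (proj₁ (proj₂ (fibre σ)) eq)

  glue : Fin (n * a) → Fin b
  glue = glue′ ∘ remQuot a

  combine′ : Fin n × Fin a → Fin (n * a)
  combine′ (σ , p) = combine σ p

  glue-injective : Injective _≡_ _≡_ glue
  glue-injective {x} {y} eq = begin
    x                      ≡⟨ combine-remQuot {n} a x ⟨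
    combine′ (remQuot a x) ≡⟨ cong combine′ (glue′-injective eq) ⟩
    combine′ (remQuot a y) ≡⟨ combine-remQuot {n} a y ⟩
    y                      ∎
    where open ≡-Reasoning

punchIn-cases : ∀ {m} (i : Fin (suc m)) (Q : Fin (suc m) → Set) →
  Q i → (∀ j → Q (punchIn i j)) → ∀ j → Q j
punchIn-cases i Q Qi Qpunch j with i F.≟ j
... | yes refl = Qi
... | no i≢j   = subst Q (punchIn-punchOut i≢j) (Qpunch (punchOut i≢j))

insert : ∀ {m} {v : Sizes (suc m)} (i : Fin (suc m)) →
  Maybe (Fin (v i)) → PInteraction m (removeAt v i) → PInteraction (suc m) v
insert                 fz     x τ fz     = x
insert                 fz     x τ (fs j) = τ j
insert {suc m}         (fs i) x τ fz     = τ fz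
insert {suc m} {v}     (fs i) x τ (fs j) = insert {v = v ∘ fs} i x (τ ∘ fs) j

insert-at : ∀ {m} {v : Sizes (suc m)} (i : Fin (suc m)) x (τ : PInteraction m (removeAt v i)) →
  insert {v = v} i x τ i ≡ x
insert-at             fz     x τ = refl
insert-at {suc m} {v} (fs i) x τ = insert-at {v = v ∘ fs} i x (τ ∘ fs)

insert-punchIn : ∀ {m} {v : Sizes (suc m)} (i : Fin (suc m)) x (τ : PInteraction m (removeAt v i)) j →
  insert {v = v} i x τ (punchIn i j) ≡ τ j
insert-punchIn             fz     x τ j      = refl
insert-punchIn {suc m}     (fs i) x τ fz     = refl
insert-punchIn {suc m} {v} (fs i) x τ (fs j) = insert-punchIn {v = v ∘ fs} i x (τ ∘ fs) j

strength-cons : ∀ {k v} (τ : PInteraction (suc k) v) → strength τ ≡ isJustℕ (τ fz) + strength (τ ∘ fs)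
strength-cons τ = cong (λ xs → isJustℕ (τ fz) + sum xs)
  (trans (map-tabulate fs (λ j → isJustℕ (τ j))) (sym (map-tabulate (λ j → j) (λ j → isJustℕ (τ (fs j))))))

strength-insert-just : ∀ {m} {v : Sizes (suc m)} (i : Fin (suc m)) σ (τ : PInteraction m (removeAt v i)) →
  strength (insert {v = v} i (just σ) τ) ≡ suc (strength τ)
strength-insert-just fz σ τ = strength-cons (insert fz (just σ) τ)
strength-insert-just {suc m} {v} (fs i) σ τ = begin
  strength (insert {v = v} (fs i) (just σ) τ)           ≡⟨ strength-cons (insert {v = v} (fs i) (just σ) τ) ⟩
  isJustℕ (τ fz) + strength (insert {v = v ∘ fs} i (just σ) (τ ∘ fs))
                                                        ≡⟨ cong (isJustℕ (τ fz) +_) (strength-insert-just {v = v ∘ fs} i σ (τ ∘ fs)) ⟩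
  isJustℕ (τ fz) + suc (strength (τ ∘ fs))              ≡⟨ +-suc (isJustℕ (τ fz)) _ ⟩
  suc (isJustℕ (τ fz) + strength (τ ∘ fs))              ≡⟨ cong suc (strength-cons τ) ⟨
  suc (strength τ)                                      ∎
  where open ≡-Reasoning

extend : ∀ {t m} {v : Sizes (suc m)} (i : Fin (suc m)) → Fin (v i) →
  Interaction t m (removeAt v i) → Interaction (suc t) (suc m) v
extend {v = v} i σ (mkI τ τ-t-way) =
  mkI (insert i (just σ) τ) (trans (strength-insert-just {v = v} i σ τ) (cong suc τ-t-way))

extend-injective : ∀ {t m} {v : Sizes (suc m)} (i : Fin (suc m)) (σ : Fin (v i))
  {T₁ T₂ : Interaction t m (removeAt v i)} → extend i σ T₁ ≈I extend i σ T₂ → T₁ ≈I T₂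
extend-injective {v = v} i σ {mkI τ₁ _} {mkI τ₂ _} eq j =
  trans (sym (insert-punchIn {v = v} i _ τ₁ j)) (trans (eq (punchIn i j)) (insert-punchIn {v = v} i _ τ₂ j))

removeColumn : ∀ {N m} {v : Sizes (suc m)} → Array N (suc m) v → (i : Fin (suc m)) → Array N m (removeAt v i)
removeColumn A i r j = A r (punchIn i j)

module _ {N t m : ℕ} {v : Sizes (suc m)} (A : Array N (suc m) v) (i : Fin (suc m)) (σ : Fin (v i)) where

  InRho-extend⁺ : ∀ {T : Interaction t m (removeAt v i)} {r} →
    A r i ≡ σ → InRho (removeColumn A i) T r → InRho A (extend i σ T) r
  InRho-extend⁺ {mkI τ _} {r} Ari≡σ r∈T =
    punchIn-cases i (λ j → ∀ σ′ → insert {v = v} i (just σ) τ j ≡ just σ′ → A r j ≡ σ′)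
    (λ σ′ eq → trans Ari≡σ (just-injective (trans (sym (insert-at {v = v} i _ τ)) eq)))
    (λ j σ′ eq → r∈T j σ′ (trans (sym (insert-punchIn {v = v} i _ τ j)) eq))

  InRho-extend⁻ : ∀ {T : Interaction t m (removeAt v i)} {r} →
    InRho A (extend i σ T) r → A r i ≡ σ × InRho (removeColumn A i) T r
  InRho-extend⁻ {mkI τ _} r∈ = r∈ i σ (insert-at {v = v} i _ τ)
                , λ j σ′ eq → r∈ (punchIn i j) σ′ (trans (insert-punchIn {v = v} i _ τ j) eq)

EqSet⇒SameRows : ∀ {N t k v} (A : Array N k v) (𝒯₁ 𝒯₂ : Maybe (Interaction t k v)) →
  EqSet 𝒯₁ 𝒯₂ → SameRows A 𝒯₁ 𝒯₂
EqSet⇒SameRows A nothing   nothing   _   r = (λ ()) , (λ ())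
EqSet⇒SameRows A (just T₁) (just T₂) T₁≈T₂ r =
  (λ r∈ j σ eq → r∈ j σ (trans (T₁≈T₂ j) eq)) , (λ r∈ j σ eq → r∈ j σ (trans (sym (T₁≈T₂ j)) eq))

module Slice {b m} {v : Sizes (suc m)} (A : Array b (suc m) v) (i : Fin (suc m)) (σ : Fin (v i)) where

  open Enumeration (enumerate (λ r → A r i F.≟ σ)) public

  slice : Array size m (removeAt v i)
  slice = removeColumn A i ∘ elem

  private
    extend? : ∀ {t} → Maybe (Interaction t m (removeAt v i)) → Maybe (Interaction (suc t) (suc m) v)
    extend? = Maybe.map (extend i σ)

  InRhoSet-extend : ∀ {t} (𝒯 : Maybe (Interaction t m (removeAt v i))) p →
    InRhoSet slice 𝒯 p → InRhoSet A (extend? 𝒯) (elem p)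
  InRhoSet-extend (just T) p = InRho-extend⁺ A i σ {T} (elem-sound p)

  rows⊆-extend : ∀ {t} (𝒯₁ 𝒯₂ : Maybe (Interaction t m (removeAt v i))) →
    (∀ p → InRhoSet slice 𝒯₁ p → InRhoSet slice 𝒯₂ p) →
    ∀ r → InRhoSet A (extend? 𝒯₁) r → InRhoSet A (extend? 𝒯₂) r
  rows⊆-extend (just T₁) 𝒯₂ ⊆ r r∈ with InRho-extend⁻ A i σ {T₁} r∈
  ... | Ari≡σ , r∈T₁ with elem-complete Ari≡σ
  ... | p , refl = InRhoSet-extend 𝒯₂ p (⊆ p r∈T₁)

  SameRows-extend : ∀ {t} (𝒯₁ 𝒯₂ : Maybe (Interaction t m (removeAt v i))) →
    SameRows slice 𝒯₁ 𝒯₂ → SameRows A (extend? 𝒯₁) (extend? 𝒯₂)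
  SameRows-extend 𝒯₁ 𝒯₂ same r =
    rows⊆-extend 𝒯₁ 𝒯₂ (proj₁ ∘ same) r , rows⊆-extend 𝒯₂ 𝒯₁ (proj₂ ∘ same) r

  EqSet-extend⁻ : ∀ {t} (𝒯₁ 𝒯₂ : Maybe (Interaction t m (removeAt v i))) →
    EqSet (extend? 𝒯₁) (extend? 𝒯₂) → EqSet 𝒯₁ 𝒯₂
  EqSet-extend⁻ nothing   nothing   _ = tt
  EqSet-extend⁻ (just T₁) (just T₂) = extend-injective i σ {T₁} {T₂}

  slice-isLA : ∀ {t} → IsLA (suc t) b (suc m) v A → IsLA t size m (removeAt v i) slice
  slice-isLA A-LA 𝒯₁ 𝒯₂ =
    EqSet-extend⁻ 𝒯₁ 𝒯₂ ∘ proj₁ (A-LA (extend? 𝒯₁) (extend? 𝒯₂)) ∘ SameRows-extend 𝒯₁ 𝒯₂ ,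
    EqSet⇒SameRows slice 𝒯₁ 𝒯₂

lemma4p8 : (t m : ℕ) → 2 ≤ t → t < suc m →
    (v : Fin (suc m) → ℕ) → (∀ j → 2 ≤ v j) → (∀ a b → a F.≤ b → v a ≤ v b) →
    (i : Fin (suc m)) → (a b : ℕ) →
    IsLAN (t ∸ 1) m (removeAt v i) a → IsLAN t (suc m) v b →
    v i * a ≤ b
lemma4p8 zero    _ ()
lemma4p8 (suc t) m _ _ v _ _ i a b (_ , minimal) ((A , A-LA) , _) =
  fibre-injections⇒*≤ (λ r → A r i) λ σ →
    let open Slice A i σ in injection≤ (minimal size (slice , slice-isLA A-LA))
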